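{- Let $\mathbb{F}$ be a field and let $A, B \subseteq \mathbb{F}^n$ be linear codes, both with trivial hull (i.e. $A\cap A^\perp=\{0\}$ and $B\cap B^\perp=\{0\}$, orthogonality taken with respect to the Euclidean inner product $\langle x,y\rangle=\sum_i x_iy_i$). For a code $U$ with trivial hull and any generator matrix $G_U$ of $U$, let $\Sigma_U = G_U^T (G_U G_U^T)^{ -1} G_U$ (an $n\times n$ symmetric matrix independent of the choice of $G_U$), and let $\mathcal{G}_U$ be the weighted undirected graph on vertex set $\{1,\dots,n\}$ with adjacency matrix $\Sigma_U$. Then for every $n\times n$ permutation matrix $X$: $B = AX := \{aX : a \in A\}$ if and only if $\Sigma_B = X^T \Sigma_A X$, i.e. if and only if $X$ defines an isomorphism of weighted graphs from $\mathcal{G}_A$ to $\mathcal{G}_B$. In particular $A$ and $B$ are permutation equivalent if and only if $\mathcal{G}_A$ and $\mathcal{G}_B$ are isomorphic as weighted graphs.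
   Context: A linear code of length $n$ over $\mathbb{F}$ is a linear subspace of $\mathbb{F}^n$; a generator matrix is a matrix whose rows form a basis. Two codes $A,B$ are permutation equivalent if $B=AX$ for some permutation matrix $X$. A weighted graph on $\{1,\dots,n\}$ with weights in $\mathbb{F}$ is encoded by its adjacency matrix (entry $(i,j)$ is the weight of edge $(i,j)$, or $0$ if there is no edge); two such graphs with adjacency matrices $M_1,M_2$ are isomorphic via the permutation matrix $X$ when $M_2 = X^T M_1 X$. -}

module Defs where

open import Level using (Level; _⊔_) renaming (suc to lsuc)
open import Data.Nat using (ℕ; zero; suc)
open import Data.Fin using (Fin; zero; suc)
open import Data.Fin.Properties using (_≟_)
open import Data.Fin.Permutation using (Permutation′; _⟨$⟩ʳ_)
open import Data.Product using (Σ; ∃; _×_; _,_)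
open import Relation.Nullary using (¬_; does)
open import Data.Bool using (if_then_else_)
open import Algebra.Bundles using (CommutativeRing)

record Field c ℓ : Set (lsuc (c ⊔ ℓ)) where
  field
    commutativeRing : CommutativeRing c ℓ
  open CommutativeRing commutativeRing public
  field
    0≉1     : ¬ (0# ≈ 1#)
    inverse : ∀ x → ¬ (x ≈ 0#) → ∃ λ y → x * y ≈ 1#

module LinearAlgebra {c ℓ} (F : Field c ℓ) where
  open Field F using (Carrier; _≈_; _+_; _*_; 0#; 1#)

  -- vectors in F^n (row vectors) and m×n matrices
  Vector : ℕ → Set c
  Vector n = Fin n → Carrier

  Matrix : ℕ → ℕ → Set c
  Matrix m n = Fin m → Fin n → Carrier

  ∑ : ∀ {n} → (Fin n → Carrier) → Carrier
  ∑ {zero}  f = 0#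
  ∑ {suc n} f = f zero + ∑ (λ i → f (suc i))

  _≈ᵥ_ : ∀ {n} → Vector n → Vector n → Set ℓ
  x ≈ᵥ y = ∀ i → x i ≈ y i

  _≈ₘ_ : ∀ {m n} → Matrix m n → Matrix m n → Set ℓ
  M ≈ₘ N = ∀ i j → M i j ≈ N i j

  0ᵥ : ∀ {n} → Vector n
  0ᵥ _ = 0#

  ⟨_,_⟩ : ∀ {n} → Vector n → Vector n → Carrier
  ⟨ x , y ⟩ = ∑ (λ i → x i * y i)

  _ᵀ : ∀ {m n} → Matrix m n → Matrix n m
  (M ᵀ) i j = M j i

  _⊗_ : ∀ {m k n} → Matrix m k → Matrix k n → Matrix m n
  (M ⊗ N) i j = ∑ (λ l → M i l * N l j)

  _·_ : ∀ {k n} → Vector k → Matrix k n → Vector n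
  (x · M) j = ∑ (λ i → x i * M i j)

  I : ∀ {n} → Matrix n n
  I i j = if does (i ≟ j) then 1# else 0#

  permMatrix : ∀ {n} → Permutation′ n → Matrix n n
  permMatrix π i j = if does ((π ⟨$⟩ʳ i) ≟ j) then 1# else 0#

  Code : ∀ {p} → ℕ → Set (c ⊔ lsuc p)
  Code {p} n = Vector n → Set p

  IsGeneratorMatrix : ∀ {p n k} → Code {p} n → Matrix k n → Set (c ⊔ ℓ ⊔ p)
  IsGeneratorMatrix U G =
    (∀ (a : Vector _) → (a · G) ≈ᵥ 0ᵥ → a ≈ᵥ 0ᵥ)
    × (∀ x → U x → ∃ λ a → x ≈ᵥ (a · G))
    × (∀ x a → x ≈ᵥ (a · G) → U x)

  IsLinearCode : ∀ {p n} → Code {p} n → Set (c ⊔ ℓ ⊔ p)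
  IsLinearCode {n = n} U = Σ ℕ λ k → Σ (Matrix k n) λ G → IsGeneratorMatrix U G

  TrivialHull : ∀ {p n} → Code {p} n → Set (c ⊔ ℓ ⊔ p)
  TrivialHull U = ∀ x → U x → (∀ y → U y → ⟨ x , y ⟩ ≈ 0#) → x ≈ᵥ 0ᵥ

  -- S is Σ_U = G_U^T (G_U G_U^T)^{-1} G_U for some generator matrix G_U of U
  -- (M below is the two-sided inverse of G_U G_U^T)
  IsSigma : ∀ {p n} → Code {p} n → Matrix n n → Set (c ⊔ ℓ ⊔ p)
  IsSigma {n = n} U S =
    Σ ℕ λ k → Σ (Matrix k n) λ G → Σ (Matrix k k) λ M →
      IsGeneratorMatrix U G
      × ((M ⊗ (G ⊗ (G ᵀ))) ≈ₘ I)
      × (((G ⊗ (G ᵀ)) ⊗ M) ≈ₘ I)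
      × (S ≈ₘ (((G ᵀ) ⊗ M) ⊗ G))

  _≡Code_·_ : ∀ {p n} → Code {p} n → Code {p} n → Matrix n n → Set (c ⊔ ℓ ⊔ p)
  B ≡Code A · X = ∀ y → (B y → ∃ λ a → A a × y ≈ᵥ (a · X))
                       × ((∃ λ a → A a × y ≈ᵥ (a · X)) → B y)

module Submission where

-- Σ_U is the orthogonal projection onto U: every x Σ_U lies in U and ⟨x Σ_U, u⟩ = ⟨x, u⟩
-- for u ∈ U. When U has trivial hull a vector of U is determined by its inner products with
-- U, so this property characterises Σ_U and forces Σ_U to fix U. A permutation matrix X is
-- orthogonal, so Xᵀ Σ_A X is the orthogonal projection onto A X: if B = A X it must be Σ_B,
-- and conversely if it is Σ_B then B, the set of vectors Σ_B fixes, is A X.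

open import Defs
open import Level using (Level; _⊔_)
open import Data.Nat using (ℕ; zero; suc)
open import Data.Fin using (Fin; zero; suc)
open import Data.Fin.Properties using (_≟_)
open import Data.Fin.Permutation using (Permutation′; _⟨$⟩ʳ_; _⟨$⟩ˡ_; inverseˡ)
open import Data.Product using (_×_; _,_; proj₁; proj₂)
open import Relation.Nullary using (yes; no)
open import Relation.Nullary.Negation using (contradiction)
import Relation.Binary.PropositionalEquality as ≡
import Relation.Binary.Reasoning.Setoid as SetoidReasoning
import Data.Vec.Functional.Relation.Binary.Equality.Setoid as VectorEquality

module OrthogonalProjection {c ℓ} (F : Field c ℓ) where
  open Field F hiding (zero)
  open LinearAlgebra F
  open import Algebra.Properties.CommutativeSemigroup +-commutativeSemigroup using (interchange)
  open import Algebra.Properties.Group +-group using (ε⁻¹≈ε; x∙y⁻¹≈ε⇒x≈y; x≈y⇒x∙y⁻¹≈ε)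
  open import Algebra.Properties.AbelianGroup +-abelianGroup using (⁻¹-∙-comm)
  open import Algebra.Properties.Ring ring using ([y-z]x≈yx-zx)
  open VectorEquality setoid using (≋-refl; ≋-sym; ≋-trans)

  ∑-cong : ∀ {n} {f g : Vector n} → f ≈ᵥ g → ∑ f ≈ ∑ g
  ∑-cong {zero}  f≈g = refl
  ∑-cong {suc n} f≈g = +-cong (f≈g zero) (∑-cong (λ i → f≈g (suc i)))

  ∑-zero : ∀ n → ∑ {n} 0ᵥ ≈ 0#
  ∑-zero zero    = refl
  ∑-zero (suc n) = trans (+-identityˡ _) (∑-zero n)

  ∑-distrib-+ : ∀ {n} (f g : Vector n) → ∑ (λ i → f i + g i) ≈ ∑ f + ∑ g
  ∑-distrib-+ {zero}  f g = sym (+-identityˡ 0#)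
  ∑-distrib-+ {suc n} f g =
    trans (+-congˡ (∑-distrib-+ (λ i → f (suc i)) (λ i → g (suc i)))) (interchange _ _ _ _)

  ∑-distrib-neg : ∀ {n} (f : Vector n) → ∑ (λ i → - f i) ≈ - ∑ f
  ∑-distrib-neg {zero}  f = sym ε⁻¹≈ε
  ∑-distrib-neg {suc n} f = trans (+-congˡ (∑-distrib-neg (λ i → f (suc i)))) (⁻¹-∙-comm _ _)

  ∑-distrib-- : ∀ {n} (f g : Vector n) → ∑ (λ i → f i - g i) ≈ ∑ f - ∑ g
  ∑-distrib-- f g = trans (∑-distrib-+ f (λ i → - g i)) (+-congˡ (∑-distrib-neg g))

  *-distribˡ-∑ : ∀ {n} a (f : Vector n) → a * ∑ f ≈ ∑ (λ i → a * f i)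
  *-distribˡ-∑ {zero}  a f = zeroʳ a
  *-distribˡ-∑ {suc n} a f = trans (distribˡ a _ _) (+-congˡ (*-distribˡ-∑ a (λ i → f (suc i))))

  *-distribʳ-∑ : ∀ {n} a (f : Vector n) → ∑ f * a ≈ ∑ (λ i → f i * a)
  *-distribʳ-∑ {zero}  a f = zeroˡ a
  *-distribʳ-∑ {suc n} a f = trans (distribʳ a _ _) (+-congˡ (*-distribʳ-∑ a (λ i → f (suc i))))

  ∑-comm : ∀ {m n} (f : Fin m → Fin n → Carrier) →
           ∑ (λ i → ∑ (λ j → f i j)) ≈ ∑ (λ j → ∑ (λ i → f i j))
  ∑-comm {zero}  {n} f = sym (∑-zero n)
  ∑-comm {suc m} f =
    trans (+-congˡ (∑-comm (λ i → f (suc i)))) (sym (∑-distrib-+ (f zero) _))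

  ∑-selectˡ : ∀ {n} (i : Fin n) (f : Vector n) → ∑ (λ j → I i j * f j) ≈ f i
  ∑-selectˡ {suc n} zero f =
    trans (+-cong (*-identityˡ _) (trans (∑-cong (λ j → zeroˡ (f (suc j)))) (∑-zero n)))
          (+-identityʳ _)
  ∑-selectˡ {suc n} (suc i) f =
    trans (+-cong (zeroˡ _) (∑-selectˡ i (λ j → f (suc j)))) (+-identityˡ _)

  ∑-selectʳ : ∀ {n} (i : Fin n) (f : Vector n) → ∑ (λ j → f j * I j i) ≈ f i
  ∑-selectʳ {suc n} zero f =
    trans (+-cong (*-identityʳ _) (trans (∑-cong (λ j → zeroʳ (f (suc j)))) (∑-zero n)))
          (+-identityʳ _)
  ∑-selectʳ {suc n} (suc i) f =
    trans (+-cong (zeroʳ _) (∑-selectʳ i (λ j → f (suc j)))) (+-identityˡ _)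

  _-ᵥ_ : ∀ {n} → Vector n → Vector n → Vector n
  (x -ᵥ y) i = x i - y i

  -ᵥ-cong : ∀ {n} {x x′ y y′ : Vector n} → x ≈ᵥ x′ → y ≈ᵥ y′ → (x -ᵥ y) ≈ᵥ (x′ -ᵥ y′)
  -ᵥ-cong x≈x′ y≈y′ i = +-cong (x≈x′ i) (-‿cong (y≈y′ i))

  ·-congˡ : ∀ {k n} (x : Vector k) {M N : Matrix k n} → M ≈ₘ N → (x · M) ≈ᵥ (x · N)
  ·-congˡ x M≈N j = ∑-cong (λ i → *-congˡ (M≈N i j))

  ·-congʳ : ∀ {k n} {x y : Vector k} (M : Matrix k n) → x ≈ᵥ y → (x · M) ≈ᵥ (y · M)
  ·-congʳ M x≈y j = ∑-cong (λ i → *-congʳ (x≈y i))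

  ·-assoc : ∀ {k m n} (x : Vector k) (M : Matrix k m) (N : Matrix m n) →
            ((x · M) · N) ≈ᵥ (x · (M ⊗ N))
  ·-assoc x M N j = begin
    ∑ (λ l → ∑ (λ i → x i * M i l) * N l j)    ≈⟨ ∑-cong (λ l → *-distribʳ-∑ (N l j) (λ i → x i * M i l)) ⟩
    ∑ (λ l → ∑ (λ i → x i * M i l * N l j))    ≈⟨ ∑-comm (λ l i → x i * M i l * N l j) ⟩
    ∑ (λ i → ∑ (λ l → x i * M i l * N l j))    ≈⟨ ∑-cong (λ i → ∑-cong (λ l → *-assoc (x i) (M i l) (N l j))) ⟩
    ∑ (λ i → ∑ (λ l → x i * (M i l * N l j)))  ≈⟨ ∑-cong (λ i → *-distribˡ-∑ (x i) (λ l → M i l * N l j)) ⟨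
    ∑ (λ i → x i * ∑ (λ l → M i l * N l j))    ∎
    where open SetoidReasoning setoid

  ·-identityʳ : ∀ {n} (x : Vector n) → (x · I) ≈ᵥ x
  ·-identityʳ x j = ∑-selectʳ j x

  I-·-row : ∀ {k n} (i : Fin k) (M : Matrix k n) → (I i · M) ≈ᵥ M i
  I-·-row i M j = ∑-selectˡ i (λ l → M l j)

  ·-distribʳ-- : ∀ {k n} (x y : Vector k) (M : Matrix k n) →
                 ((x -ᵥ y) · M) ≈ᵥ ((x · M) -ᵥ (y · M))
  ·-distribʳ-- x y M j =
    trans (∑-cong (λ i → [y-z]x≈yx-zx (M i j) (x i) (y i)))
          (∑-distrib-- (λ i → x i * M i j) (λ i → y i * M i j))

  ⟨⟩-cong : ∀ {n} {x x′ y y′ : Vector n} → x ≈ᵥ x′ → y ≈ᵥ y′ → ⟨ x , y ⟩ ≈ ⟨ x′ , y′ ⟩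
  ⟨⟩-cong x≈x′ y≈y′ = ∑-cong (λ i → *-cong (x≈x′ i) (y≈y′ i))

  ⟨⟩-distribʳ-- : ∀ {n} (x y z : Vector n) → ⟨ x -ᵥ y , z ⟩ ≈ ⟨ x , z ⟩ - ⟨ y , z ⟩
  ⟨⟩-distribʳ-- x y z =
    trans (∑-cong (λ i → [y-z]x≈yx-zx (z i) (x i) (y i)))
          (∑-distrib-- (λ i → x i * z i) (λ i → y i * z i))

  ⟨·⟩-adjoint : ∀ {k n} (x : Vector k) (M : Matrix k n) (z : Vector n) →
                ⟨ x · M , z ⟩ ≈ ⟨ x , z · (M ᵀ) ⟩
  ⟨·⟩-adjoint x M z = begin
    ∑ (λ j → ∑ (λ i → x i * M i j) * z j)    ≈⟨ ∑-cong (λ j → *-distribʳ-∑ (z j) (λ i → x i * M i j)) ⟩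
    ∑ (λ j → ∑ (λ i → x i * M i j * z j))    ≈⟨ ∑-comm (λ j i → x i * M i j * z j) ⟩
    ∑ (λ i → ∑ (λ j → x i * M i j * z j))    ≈⟨ ∑-cong (λ i → ∑-cong (λ j → rearrange (x i) (M i j) (z j))) ⟩
    ∑ (λ i → ∑ (λ j → x i * (z j * M i j)))  ≈⟨ ∑-cong (λ i → *-distribˡ-∑ (x i) (λ j → z j * M i j)) ⟨
    ∑ (λ i → x i * ∑ (λ j → z j * M i j))    ∎
    where
    open SetoidReasoning setoid
    rearrange : ∀ a b c → a * b * c ≈ a * (c * b)
    rearrange a b c = trans (*-assoc a b c) (*-congˡ (*-comm b c))

  IsOrthogonal : ∀ {n} → Matrix n n → Set ℓ
  IsOrthogonal X = (X ⊗ (X ᵀ)) ≈ₘ I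

  module _ {n} {X : Matrix n n} (X-orthogonal : IsOrthogonal X) where

    orthogonal-cancelʳ : ∀ x → ((x · X) · (X ᵀ)) ≈ᵥ x
    orthogonal-cancelʳ x =
      ≋-trans (·-assoc x X (X ᵀ)) (≋-trans (·-congˡ x X-orthogonal) (·-identityʳ x))

    orthogonal-preserves-⟨⟩ : ∀ x y → ⟨ x · X , y · X ⟩ ≈ ⟨ x , y ⟩
    orthogonal-preserves-⟨⟩ x y =
      trans (⟨·⟩-adjoint x X (y · X)) (⟨⟩-cong ≋-refl (orthogonal-cancelʳ y))

  I-reindex : ∀ {n} (π : Permutation′ n) (i j : Fin n) → I (π ⟨$⟩ʳ i) (π ⟨$⟩ʳ j) ≈ I i j
  I-reindex π i j with i ≟ j | (π ⟨$⟩ʳ i) ≟ (π ⟨$⟩ʳ j)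
  ... | yes _   | yes _   = refl
  ... | no _    | no _    = refl
  ... | yes i≡j | no πi≢πj = contradiction (≡.cong (π ⟨$⟩ʳ_) i≡j) πi≢πj
  ... | no i≢j  | yes πi≡πj =
    contradiction (≡.trans (≡.sym (inverseˡ π)) (≡.trans (≡.cong (π ⟨$⟩ˡ_) πi≡πj) (inverseˡ π))) i≢j

  permMatrix-orthogonal : ∀ {n} (π : Permutation′ n) → IsOrthogonal (permMatrix π)
  permMatrix-orthogonal π i j =
    trans (∑-cong (λ l → *-comm (permMatrix π i l) (permMatrix π j l)))
      (trans (∑-selectˡ (π ⟨$⟩ʳ j) (permMatrix π i)) (I-reindex π i j))

  module _ {p n} {U : Code {p} n} where

    linear-resp : IsLinearCode U → ∀ {x y} → x ≈ᵥ y → U x → U y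
    linear-resp (_ , _ , _ , U⊆span , span⊆U) {x} {y} x≈y x∈U with U⊆span x x∈U
    ... | a , x≈aG = span⊆U y a (≋-trans (≋-sym x≈y) x≈aG)

    linear-closed-- : IsLinearCode U → ∀ {x y} → U x → U y → U (x -ᵥ y)
    linear-closed-- (_ , G , _ , U⊆span , span⊆U) {x} {y} x∈U y∈U
      with U⊆span x x∈U | U⊆span y y∈U
    ... | a , x≈aG | b , y≈bG =
      span⊆U (x -ᵥ y) (a -ᵥ b) (≋-trans (-ᵥ-cong x≈aG y≈bG) (≋-sym (·-distribʳ-- a b G)))

    trivialHull-⟨⟩-injective : IsLinearCode U → TrivialHull U → ∀ {x y} → U x → U y →
                               (∀ u → U u → ⟨ x , u ⟩ ≈ ⟨ y , u ⟩) → x ≈ᵥ y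
    trivialHull-⟨⟩-injective linear hull {x} {y} x∈U y∈U ⟨x⟩≈⟨y⟩ i =
      x∙y⁻¹≈ε⇒x≈y (x i) (y i) (hull (x -ᵥ y) (linear-closed-- linear x∈U y∈U) x-y⊥U i)
      where
      x-y⊥U : ∀ u → U u → ⟨ x -ᵥ y , u ⟩ ≈ 0#
      x-y⊥U u u∈U = trans (⟨⟩-distribʳ-- x y u) (x≈y⇒x∙y⁻¹≈ε (⟨x⟩≈⟨y⟩ u u∈U))

  IsOrthogonalProjection : ∀ {p n} → Code {p} n → Matrix n n → Set (ℓ ⊔ p ⊔ c)
  IsOrthogonalProjection U P =
    (∀ x → U (x · P)) × (∀ x u → U u → ⟨ x · P , u ⟩ ≈ ⟨ x , u ⟩)

  Σ-isOrthogonalProjection : ∀ {p n} {U : Code {p} n} {S : Matrix n n} →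
                             IsSigma U S → IsOrthogonalProjection U S
  Σ-isOrthogonalProjection {n = n} {U} {S} (k , G , M , (_ , U⊆span , span⊆U) , M-inverse , _ , S≈GᵀMG) =
    (λ x → span⊆U (x · S) (coefficients x) (S-factors x)) , S-self-adjoint
    where
    coefficients : Vector n → Vector k
    coefficients x = (x · (G ᵀ)) · M

    S-factors : ∀ x → (x · S) ≈ᵥ (coefficients x · G)
    S-factors x = ≋-trans (·-congˡ x S≈GᵀMG)
      (≋-trans (≋-sym (·-assoc x ((G ᵀ) ⊗ M) G)) (·-congʳ G (≋-sym (·-assoc x (G ᵀ) M))))

    S-self-adjoint : ∀ x u → U u → ⟨ x · S , u ⟩ ≈ ⟨ x , u ⟩
    S-self-adjoint x u u∈U with U⊆span u u∈U
    ... | a , u≈aG = begin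
      ⟨ x · S , u ⟩                                      ≈⟨ ⟨⟩-cong (S-factors x) u≈aG ⟩
      ⟨ coefficients x · G , a · G ⟩                     ≈⟨ ⟨·⟩-adjoint (coefficients x · G) (G ᵀ) a ⟨
      ⟨ (coefficients x · G) · (G ᵀ) , a ⟩               ≈⟨ ⟨⟩-cong (·-assoc (coefficients x) G (G ᵀ)) ≋-refl ⟩
      ⟨ coefficients x · (G ⊗ (G ᵀ)) , a ⟩               ≈⟨ ⟨⟩-cong (·-assoc (x · (G ᵀ)) M (G ⊗ (G ᵀ))) ≋-refl ⟩
      ⟨ (x · (G ᵀ)) · (M ⊗ (G ⊗ (G ᵀ))) , a ⟩            ≈⟨ ⟨⟩-cong M-cancels ≋-refl ⟩
      ⟨ x · (G ᵀ) , a ⟩                                  ≈⟨ ⟨·⟩-adjoint x (G ᵀ) a ⟩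
      ⟨ x , a · G ⟩                                      ≈⟨ ⟨⟩-cong ≋-refl u≈aG ⟨
      ⟨ x , u ⟩                                          ∎
      where
      open SetoidReasoning setoid
      M-cancels : ((x · (G ᵀ)) · (M ⊗ (G ⊗ (G ᵀ)))) ≈ᵥ (x · (G ᵀ))
      M-cancels = ≋-trans (·-congˡ (x · (G ᵀ)) M-inverse) (·-identityʳ (x · (G ᵀ)))

  module _ {p n} {U : Code {p} n} (linear : IsLinearCode U) (hull : TrivialHull U) where

    projection-fixes : ∀ {P} → IsOrthogonalProjection U P → ∀ {u} → U u → (u · P) ≈ᵥ u
    projection-fixes (P-into , P-adjoint) {u} u∈U =
      trivialHull-⟨⟩-injective linear hull (P-into u) u∈U (P-adjoint u)

    projection-unique : ∀ {P Q} → IsOrthogonalProjection U P → IsOrthogonalProjection U Q → P ≈ₘ Q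
    projection-unique {P} {Q} (P-into , P-adjoint) (Q-into , Q-adjoint) i =
      ≋-trans (≋-sym (I-·-row i P)) (≋-trans xP≈xQ (I-·-row i Q))
      where
      xP≈xQ : (I i · P) ≈ᵥ (I i · Q)
      xP≈xQ = trivialHull-⟨⟩-injective linear hull (P-into (I i)) (Q-into (I i))
                (λ u u∈U → trans (P-adjoint (I i) u u∈U) (sym (Q-adjoint (I i) u u∈U)))

  conjugate : ∀ {n} → Matrix n n → Matrix n n → Matrix n n
  conjugate X P = ((X ᵀ) ⊗ P) ⊗ X

  module _ {n} {X : Matrix n n} (X-orthogonal : IsOrthogonal X) where

    ·-conjugate : ∀ x P → (x · conjugate X P) ≈ᵥ (((x · (X ᵀ)) · P) · X)
    ·-conjugate x P =
      ≋-trans (≋-sym (·-assoc x ((X ᵀ) ⊗ P) X)) (·-congʳ X (≋-sym (·-assoc x (X ᵀ) P)))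

    conjugate-isOrthogonalProjection : ∀ {p} {A B : Code {p} n} {P} → B ≡Code A · X →
      IsOrthogonalProjection A P → IsOrthogonalProjection B (conjugate X P)
    conjugate-isOrthogonalProjection {B = B} {P} B≡AX (P-into , P-adjoint) = T-into , T-adjoint
      where
      T-into : ∀ x → B (x · conjugate X P)
      T-into x = proj₂ (B≡AX _) (((x · (X ᵀ)) · P) , P-into (x · (X ᵀ)) , ·-conjugate x P)

      T-adjoint : ∀ x b → B b → ⟨ x · conjugate X P , b ⟩ ≈ ⟨ x , b ⟩
      T-adjoint x b b∈B with proj₁ (B≡AX b) b∈B
      ... | a , a∈A , b≈aX = begin
        ⟨ x · conjugate X P , b ⟩              ≈⟨ ⟨⟩-cong (·-conjugate x P) b≈aX ⟩
        ⟨ ((x · (X ᵀ)) · P) · X , a · X ⟩      ≈⟨ orthogonal-preserves-⟨⟩ X-orthogonal ((x · (X ᵀ)) · P) a ⟩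
        ⟨ (x · (X ᵀ)) · P , a ⟩                ≈⟨ P-adjoint (x · (X ᵀ)) a a∈A ⟩
        ⟨ x · (X ᵀ) , a ⟩                      ≈⟨ ⟨·⟩-adjoint x (X ᵀ) a ⟩
        ⟨ x , a · X ⟩                          ≈⟨ ⟨⟩-cong ≋-refl b≈aX ⟨
        ⟨ x , b ⟩                              ∎
        where open SetoidReasoning setoid

    conjugate-fixes : ∀ {p} {A : Code {p} n} {P} → IsLinearCode A → TrivialHull A →
                      IsOrthogonalProjection A P → ∀ {a} → A a → ((a · X) · conjugate X P) ≈ᵥ (a · X)
    conjugate-fixes {P = P} linear hull P-projection {a} a∈A = ≋-trans (·-conjugate (a · X) P)
      (·-congʳ X (≋-trans (·-congʳ P (orthogonal-cancelʳ X-orthogonal a))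
                          (projection-fixes linear hull P-projection a∈A)))

    conjugate-projection⇒≡Code : ∀ {p} {A B : Code {p} n} {P Q} →
      IsLinearCode A → TrivialHull A → IsLinearCode B → TrivialHull B →
      IsOrthogonalProjection A P → IsOrthogonalProjection B Q → Q ≈ₘ conjugate X P → B ≡Code A · X
    conjugate-projection⇒≡Code {A = A} {P = P} {Q}
      linearA hullA linearB hullB P-projection Q-projection Q≈XᵀPX y =
      (λ y∈B → (y · (X ᵀ)) · P , proj₁ P-projection (y · (X ᵀ)) ,
        ≋-trans (≋-sym (projection-fixes linearB hullB Q-projection y∈B))
                (≋-trans (·-congˡ y Q≈XᵀPX) (·-conjugate y P)))
      , λ { (a , a∈A , y≈aX) → linear-resp linearB (yQ≈y a a∈A y≈aX) (proj₁ Q-projection y) }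
      where
      yQ≈y : ∀ a → A a → y ≈ᵥ (a · X) → (y · Q) ≈ᵥ y
      yQ≈y a a∈A y≈aX = ≋-trans (·-congˡ y Q≈XᵀPX) (≋-trans (·-congʳ (conjugate X P) y≈aX)
        (≋-trans (conjugate-fixes linearA hullA P-projection a∈A) (≋-sym y≈aX)))

theorem1 : ∀ {c ℓ p : Level} (F : Field c ℓ) (n : ℕ)
           (A B : LinearAlgebra.Code F {p} n) →
           LinearAlgebra.IsLinearCode F A → LinearAlgebra.IsLinearCode F B →
           LinearAlgebra.TrivialHull F A → LinearAlgebra.TrivialHull F B →
           (ΣA ΣB : LinearAlgebra.Matrix F n n) →
           LinearAlgebra.IsSigma F A ΣA → LinearAlgebra.IsSigma F B ΣB →
           (π : Permutation′ n) →
           (LinearAlgebra._≡Code_·_ F B A (LinearAlgebra.permMatrix F π) →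
             LinearAlgebra._≈ₘ_ F ΣB
               (LinearAlgebra._⊗_ F
                 (LinearAlgebra._⊗_ F (LinearAlgebra._ᵀ F (LinearAlgebra.permMatrix F π)) ΣA)
                 (LinearAlgebra.permMatrix F π)))
           × (LinearAlgebra._≈ₘ_ F ΣB
               (LinearAlgebra._⊗_ F
                 (LinearAlgebra._⊗_ F (LinearAlgebra._ᵀ F (LinearAlgebra.permMatrix F π)) ΣA)
                 (LinearAlgebra.permMatrix F π)) →
             LinearAlgebra._≡Code_·_ F B A (LinearAlgebra.permMatrix F π))
theorem1 F n A B linearA linearB hullA hullB ΣA ΣB ΣA-def ΣB-def π =
  (λ B≡AX → projection-unique linearB hullB ΣB-projection
              (conjugate-isOrthogonalProjection X-orthogonal B≡AX ΣA-projection))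
  , conjugate-projection⇒≡Code X-orthogonal linearA hullA linearB hullB ΣA-projection ΣB-projection
  where
  open OrthogonalProjection F
  open LinearAlgebra F using (permMatrix)

  X-orthogonal : IsOrthogonal (permMatrix π)
  X-orthogonal = permMatrix-orthogonal π

  ΣA-projection : IsOrthogonalProjection A ΣA
  ΣA-projection = Σ-isOrthogonalProjection ΣA-def

  ΣB-projection : IsOrthogonalProjection B ΣB
  ΣB-projection = Σ-isOrthogonalProjection ΣB-def
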